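{- Let $G=(V,E)$ be a finite simple undirected graph in which every node has even degree, and run algorithm Euler-Tour on a stream of its edges, finding the cycles $C_1,\ldots,C_N$ in chronological order. Let $k,\ell\in\{0,\ldots,N\}$ with $k<\ell$. Then for any $v,v'\in V$ and $e\in R^*(E)$: (i) if $t_k(v)=t_k(v')\neq0$, then $t_\ell(v)=t_\ell(v')$; (ii) if $e\in E(C_\ell)$, then $[e]_{\delta^*_k}=[e]_{\delta^c}$.
   Context: Setting: $G=(V,E)$ is a finite simple undirected graph, streamed edge by edge, each edge read once in arbitrary order. Algorithm Euler-Tour. Initialize $c:=0$, $F:=\emptyset$ (a set of directed edges), $E_{\mathrm{int}}:=\emptyset$, and $j(v):=0$, $t(v):=0$ for all $v\in V$. Output consists of triples $(v_1,v_2,s)$, meaning $(v_2,s)$ is marked as successor of $(v_1,v_2)$. Main loop: for each streamed edge $e$, add it to $E_{\mathrm{int}}$. If $(V,E_{\mathrm{int}})$ contains a cycle $C$, call Merge-Cycle$(C)$ with $C$ given as an ordered cycle $(v_1,\ldots,v_k)$, indices cyclic. Merge-Cycle performs the following steps in order. 1. For $i=1,\ldots,k$: if $t(v_i)=0$, set $j(v_i):=v_{i+1}$ and add $(v_{i-1},v_i)$ to $F$. 2. Set $M:=\emptyset$ and $J:=\emptyset$. For each $j=1,\ldots,|V|$: if some $v_i$ has $t(v_i)=j$, add exactly one such $v_i$ to $J$ and add $j$ to $M$. 3. For each $v_i\in J$: write $(v_{i-1},v_i,j(v_i))$, then set $j(v_i):=v_{i+1}$. 4. For each edge $(v_i,v_{i+1})$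 of $C$ neither written nor added to $F$: write $(v_i,v_{i+1},v_{i+2})$. 5. If $M=\emptyset$, set $c:=c+1$ and $a:=c$; otherwise set $a:=\min M$. For each $v$ with $t(v)\in M$, set $t(v):=a$. For all $i$, set $t(v_i):=a$. 6. Delete the edges of $C$ from $E_{\mathrm{int}}$. At the end, for each $(u,v)\in F$, the triple $(u,v,j(v))$ is written. Notation: - For a variable $x$, $x_k$ denotes its value after the $k$-th call of Merge-Cycle ($x_0$ is the initial value). - $R^*(E)$ is the set of directed edges $(u,v)$ for which a triple $(u,v,s)$ is written. It contains exactly one orientation of each edge and equals $\bigcup_i E(C_i)$, where $E(C_i)$ is the set of directed edges of the ordered cycle $C_i$. - $\delta^c$ maps each directed edge $(v_j,v_{j+1})$ of an ordered cycle $C_i=(v_1,\ldots,v_{\ell_i})$ to $(v_{j+1},v_{j+2})$. - Processed edges after step $k$ are those in $\bigcup_{i\le k}E(C_i)$. Each is either of type A (written with some successor $e'$) or of type B (in $F_k$). - $\delta_k$ maps a type A edge $(u,v)$ to its written successor $e'$ and a type B edge $(u,v)$ to $(v,j_k(v))$. - $\delta^*_k$ equals $\delta_k$ on $\bigcup_{i\le k}E(C_i)$ and $\delta^c$ on $\bigcup_{i>k}E(C_i)$. - For a successor function $\delta$, $x\equiv_\delta x'$ means $\delta^m(x)=x'$ for some $m\in\mathbb{N}=\{1,2,\ldots\}$, and $[x]_\delta$ is the class of $x$. -}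

module Defs where

open import Data.Nat using (ℕ; zero; suc; _+_; _⊓_; _≡ᵇ_)
open import Data.Nat.DivMod using (_mod_)
open import Data.Fin using (Fin; toℕ)
open import Data.Fin.Properties using () renaming (_≟_ to _≟F_)
open import Data.Product using (Σ; ∃; _×_; _,_; proj₁; proj₂; swap)
open import Data.Product.Properties using (≡-dec)
open import Data.Sum using (_⊎_)
open import Data.Bool using (Bool; true; false; if_then_else_; _∧_; _∨_; not)
open import Data.Maybe using (Maybe; just; nothing; _>>=_)
open import Data.List using (List; []; _∷_; _++_; map; foldl; allFin; length; concatMap; take; drop)
open import Data.Bool.ListAction using (any)
open import Data.List.Membership.Propositional using (_∈_)
open import Data.List.Relation.Unary.All using (All)
open import Data.List.Relation.Unary.AllPairs using (AllPairs)
open import Relation.Nullary using (¬_; does)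
open import Relation.Binary.Definitions using (DecidableEquality)
open import Relation.Binary.PropositionalEquality using (_≡_; _≢_)

DEdge : ℕ → Set
DEdge n = Fin n × Fin n

-- output triple (v1 , v2 , s); s = nothing encodes the value 0 of j
Triple : ℕ → Set
Triple n = Fin n × Fin n × Maybe (Fin n)

record State (n : ℕ) : Set where
  constructor mkState
  field
    c    : ℕ
    F    : List (DEdge n)
    Eint : List (DEdge n)            -- undirected edges, stored as streamed
    j    : Fin n → Maybe (Fin n)     -- nothing = 0
    t    : Fin n → ℕ
    out  : List (Triple n)
open State public

initState : (n : ℕ) → State n
initState n = mkState 0 [] [] (λ _ → nothing) (λ _ → 0) []

-- Ordered cycles (v_1 , … , v_k), k = 3 + m ≥ 3, indices cyclic.

record OCycle (n : ℕ) : Set where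
  constructor ocycle
  field
    m  : ℕ
    vs : Fin (3 + m) → Fin n
open OCycle public

len : ∀ {n} → OCycle n → ℕ
len C = 3 + m C

-- 0-based cyclic indexing: vx C i = v_{(i mod k) + 1}
vx : ∀ {n} → OCycle n → ℕ → Fin n
vx (ocycle m vs) i = vs (i mod (3 + m))

edgeOf : ∀ {n} (C : OCycle n) → Fin (len C) → DEdge n
edgeOf C p = vx C (toℕ p) , vx C (suc (toℕ p))

-- the edge (v_{i-1} , v_i) entering position p
inEdge : ∀ {n} (C : OCycle n) → Fin (len C) → DEdge n
inEdge C p = vx C (toℕ p + (2 + m C)) , vx C (toℕ p)

_∈E_ : ∀ {n} → DEdge n → OCycle n → Set
e ∈E C = ∃ λ p → e ≡ edgeOf C p

Adj : ∀ {n} → List (DEdge n) → Fin n → Fin n → Set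
Adj Es u w = ((u , w) ∈ Es) ⊎ ((w , u) ∈ Es)

IsCycleIn : ∀ {n} → List (DEdge n) → OCycle n → Set
IsCycleIn Es C = (∀ {p q} → vs C p ≡ vs C q → p ≡ q)
               × (∀ (p : Fin (len C)) → Adj Es (vx C (toℕ p)) (vx C (suc (toℕ p))))

HasCycle : ∀ {n} → List (DEdge n) → Set
HasCycle {n} Es = Σ (OCycle n) (IsCycleIn Es)

module _ {n : ℕ} where

  _≟E_ : DecidableEquality (DEdge n)
  _≟E_ = ≡-dec _≟F_ _≟F_

  updF : {A : Set} → (Fin n → A) → Fin n → A → Fin n → A
  updF f v a w = if does (w ≟F v) then a else f w

  memE : DEdge n → List (DEdge n) → Bool
  memE e es = any (λ e' → does (e ≟E e')) es

  writtenPair : DEdge n → List (Triple n) → Bool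
  writtenPair e ts = any (λ x → does (e ≟E (proj₁ x , proj₁ (proj₂ x)))) ts

minL : List ℕ → Maybe ℕ
minL [] = nothing
minL (x ∷ xs) with minL xs
... | nothing = just x
... | just y  = just (x ⊓ y)

-- Merge-Cycle.  J : Fin (len C) → Bool is the choice made in step 2
-- (the set J, as a set of positions on C).

ValidJ : ∀ {n} → State n → (C : OCycle n) → (Fin (len C) → Bool) → Set
ValidJ s C J =
    (∀ (p : Fin (len C)) → J p ≡ true → t s (vx C (toℕ p)) ≢ 0)
  × (∀ (p : Fin (len C)) → t s (vx C (toℕ p)) ≢ 0 →
       ∃ λ q → (J q ≡ true) × (t s (vx C (toℕ q)) ≡ t s (vx C (toℕ p))))
  × (∀ (p q : Fin (len C)) → J p ≡ true → J q ≡ true →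
       t s (vx C (toℕ p)) ≡ t s (vx C (toℕ q)) → p ≡ q)

merge : ∀ {n} → State n → (C : OCycle n) → (Fin (len C) → Bool) → State n
merge {n} s C J = mkState c' F₁ E₆ j₃ t₅ out₄
  where
  P : List (Fin (len C))
  P = allFin (len C)
  v : Fin (len C) → ℕ → Fin n
  v p d = vx C (toℕ p + d)
  step1 : (Fin n → Maybe (Fin n)) × List (DEdge n) → Fin (len C)
        → (Fin n → Maybe (Fin n)) × List (DEdge n)
  step1 (jj , FF) p =
    if t s (v p 0) ≡ᵇ 0
    then (updF jj (v p 0) (just (v p 1)) , FF ++ (inEdge C p ∷ []))
    else (jj , FF)
  r1 : (Fin n → Maybe (Fin n)) × List (DEdge n)
  r1 = foldl step1 (j s , F s) P
  F₁ : List (DEdge n)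
  F₁ = proj₂ r1
  step3 : (Fin n → Maybe (Fin n)) × List (Triple n) → Fin (len C)
        → (Fin n → Maybe (Fin n)) × List (Triple n)
  step3 (jj , oo) p =
    if J p
    then (updF jj (v p 0) (just (v p 1)) ,
          oo ++ ((proj₁ (inEdge C p) , v p 0 , jj (v p 0)) ∷ []))
    else (jj , oo)
  r3 : (Fin n → Maybe (Fin n)) × List (Triple n)
  r3 = foldl step3 (proj₁ r1 , out s) P
  j₃ : Fin n → Maybe (Fin n)
  j₃ = proj₁ r3
  out₃ : List (Triple n)
  out₃ = proj₂ r3
  step4 : List (Triple n) → Fin (len C) → List (Triple n)
  step4 oo p =
    if not (writtenPair (edgeOf C p) out₃) ∧ not (memE (edgeOf C p) F₁)
    then oo ++ ((v p 0 , v p 1 , just (v p 2)) ∷ [])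
    else oo
  out₄ : List (Triple n)
  out₄ = foldl step4 out₃ P
  M : List ℕ
  M = concatMap (λ p → if J p then t s (v p 0) ∷ [] else []) P
  ca : ℕ × ℕ      -- (new c , a)
  ca with minL M
  ... | nothing = suc (c s) , suc (c s)
  ... | just μ  = c s , μ
  c' : ℕ
  c' = proj₁ ca
  onC : Fin n → Bool
  onC w = any (λ p → does (w ≟F v p 0)) P
  inM : ℕ → Bool
  inM x = any (λ y → y ≡ᵇ x) M
  t₅ : Fin n → ℕ
  t₅ w = if onC w then proj₂ ca else (if inM (t s w) then proj₂ ca else t s w)
  isCEdge : DEdge n → Bool
  isCEdge e = any (λ p → does (e ≟E edgeOf C p) ∨ does (swap e ≟E edgeOf C p)) P
  E₆ : List (DEdge n)
  E₆ = concatMap (λ e → if isCEdge e then [] else e ∷ []) (Eint s)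

-- Main loop.  A run records, for each call of Merge-Cycle, the cycle C_i
-- and the state after that call.

addEdge : ∀ {n} → DEdge n → State n → State n
addEdge e s = record s { Eint = Eint s ++ (e ∷ []) }

Trace : ℕ → Set
Trace n = List (OCycle n × State n)

data Step {n : ℕ} : State n → DEdge n → Trace n → State n → Set where
  acyclic : ∀ {s e} → ¬ HasCycle (Eint (addEdge e s))
          → Step s e [] (addEdge e s)
  found   : ∀ {s e} (C : OCycle n) (J : Fin (len C) → Bool)
          → IsCycleIn (Eint (addEdge e s)) C
          → ValidJ (addEdge e s) C J
          → Step s e ((C , merge (addEdge e s) C J) ∷ []) (merge (addEdge e s) C J)

data Run {n : ℕ} : State n → List (DEdge n) → Trace n → State n → Set where
  done : ∀ {s} → Run s [] [] s
  next : ∀ {s e es tr tr' s' s''}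
       → Step s e tr s' → Run s' es tr' s'' → Run s (e ∷ es) (tr ++ tr') s''

-- triples written in total (including the final writes for F)
finalOut : ∀ {n} → State n → List (Triple n)
finalOut s = out s ++ map (λ e → proj₁ e , proj₂ e , j s (proj₂ e)) (F s)

InRStar : ∀ {n} → State n → DEdge n → Set
InRStar s e = ∃ λ x → (proj₁ e , proj₂ e , x) ∈ finalOut s

-- x_k : state after the k-th call (x_0 = initial state)
stateAt : ∀ {n} → State n → Trace n → ℕ → State n
stateAt s₀ tr zero = s₀
stateAt s₀ [] (suc k) = s₀
stateAt s₀ (x ∷ tr) (suc k) = stateAt (proj₂ x) tr k

-- C_ℓ (1-based)
cycleAt : ∀ {n} → Trace n → ℕ → Maybe (OCycle n)
cycleAt [] _ = nothing
cycleAt (x ∷ tr) zero = nothing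
cycleAt (x ∷ tr) (suc zero) = just (proj₁ x)
cycleAt (x ∷ tr) (suc (suc ℓ)) = cycleAt tr (suc ℓ)

cycles : ∀ {n} → Trace n → List (OCycle n)
cycles tr = map proj₁ tr

-- Successor functions (partial: nothing = undefined)

inCycles : ∀ {n} → DEdge n → List (OCycle n) → Bool
inCycles e Cs = any (λ C → any (λ p → does (e ≟E edgeOf C p)) (allFin (len C))) Cs

firstJust : ∀ {A B : Set} → (A → Maybe B) → List A → Maybe B
firstJust f [] = nothing
firstJust f (x ∷ xs) with f x
... | just y  = just y
... | nothing = firstJust f xs

δc : ∀ {n} → List (OCycle n) → DEdge n → Maybe (DEdge n)
δc Cs e = firstJust (λ C → firstJust (λ p →
            if does (e ≟E edgeOf C p) then just (vx C (suc (toℕ p)) , vx C (suc (suc (toℕ p)))) else nothing)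
            (allFin (len C))) Cs

δk : ∀ {n} → State n → DEdge n → Maybe (DEdge n)
δk s e with firstJust (λ x → if does (e ≟E (proj₁ x , proj₁ (proj₂ x))) then just (proj₂ (proj₂ x)) else nothing) (out s)
... | just (just w) = just (proj₂ e , w)
... | just nothing  = nothing
... | nothing = if memE e (F s)
                then (j s (proj₂ e) >>= λ w → just (proj₂ e , w))
                else nothing

δstar : ∀ {n} → State n → Trace n → ℕ → DEdge n → Maybe (DEdge n)
δstar s₀ tr k e =
  if inCycles e (take k (cycles tr)) then δk (stateAt s₀ tr k) e
  else (if inCycles e (drop k (cycles tr)) then δc (cycles tr) e else nothing)

iter : ∀ {n} → (DEdge n → Maybe (DEdge n)) → ℕ → DEdge n → Maybe (DEdge n)
iter δ zero x = just x
iter δ (suc m) x = δ x >>= iter δ m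

Reach : ∀ {n} → (DEdge n → Maybe (DEdge n)) → DEdge n → DEdge n → Set
Reach δ x x' = ∃ λ m → iter δ (suc m) x ≡ just x'

SameClass : ∀ {n} → (DEdge n → Maybe (DEdge n)) → (DEdge n → Maybe (DEdge n)) → DEdge n → Set
SameClass δ δ' e = ∀ x → (Reach δ e x → Reach δ' e x) × (Reach δ' e x → Reach δ e x)

SimpleStream : ∀ {n} → List (DEdge n) → Set
SimpleStream es = All (λ e → proj₁ e ≢ proj₂ e) es
                × AllPairs (λ e e' → (e ≢ e') × (e ≢ swap e')) es

degree : ∀ {n} → List (DEdge n) → Fin n → ℕ
degree es v = length (concatMap (λ e → if does (v ≟F proj₁ e) ∨ does (v ≟F proj₂ e) then e ∷ [] else []) es)

module Submission where

-- (i) In one call of Merge-Cycle every vertex either keeps its label t or receives the new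
-- label a ≠ 0, and a vertex of C with a nonzero label shares it with some vertex of J, so its
-- label lies in M.  Hence on nonzero labels the new t is a function of the old one
-- (x ↦ a if x ∈ M, else x): classes of equal nonzero labels can only merge, and stay nonzero.
-- (ii) The cycles found are pairwise edge-disjoint: an edge sits in E_int only from the moment
-- it is streamed until its cycle is removed, and the stream is simple.  So no edge of C_ℓ lies
-- on C_1, …, C_k, hence δ*_k agrees with δ^c on E(C_ℓ), which δ^c maps into itself, and the
-- two successor functions have the same orbits from the edges of C_ℓ.

open import Defs
open import Data.Nat.Divisibility using (_∣_)
open import Data.Bool using (Bool; true; false; T; if_then_else_; _∨_)
open import Data.Bool.Properties using (T-∨; T?)
open import Data.Bool.ListAction using (any)
open import Data.Empty using (⊥-elim)
open import Data.Fin using (Fin; toℕ)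
open import Data.Fin.Properties using (toℕ-injective; toℕ-fromℕ<) renaming (_≟_ to _≟F_)
open import Data.List using (List; []; _∷_; _++_; allFin; concatMap; take; drop; length)
open import Data.List.Membership.Propositional using (_∈_; find; lose)
open import Data.List.Membership.Propositional.Properties
  using (∈-allFin; ∈-++⁺ˡ; ∈-++⁺ʳ; ∈-++⁻; ∈-concatMap⁺; ∈-concatMap⁻)
open import Data.List.Properties using (++-assoc)
open import Data.List.Relation.Unary.All as All using (All; []; _∷_)
open import Data.List.Relation.Unary.All.Properties using (All¬⇒¬Any)
open import Data.List.Relation.Unary.AllPairs using (AllPairs; []; _∷_)
open import Data.List.Relation.Unary.Any as Any using (Any; here; there)
open import Data.List.Relation.Unary.Any.Properties using (any⁺; any⁻; ++⁻)
open import Data.List.Relation.Binary.Subset.Propositional using (_⊆_)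
open import Data.List.Relation.Binary.Subset.Propositional.Properties using (Any-resp-⊆)
open import Data.Maybe using (Maybe; just; nothing)
open import Data.Nat using (ℕ; zero; suc; _+_; _<_; _≤_; z≤n; s≤s; _≡ᵇ_; _%_; NonZero)
open import Data.Nat.DivMod using (_mod_; m%n%n≡m%n; %-distribˡ-+)
open import Data.Nat.Properties using (+-identityʳ; ⊓-sel; ≡⇒≡ᵇ; m≤n⇒m≤1+n)
open import Data.Product using (Σ; ∃; ∃₂; _×_; _,_; proj₁; proj₂; map₂; swap; uncurry)
open import Data.Sum using (_⊎_; inj₁; inj₂; [_,_])
open import Data.Unit using (⊤; tt)
open import Function using (_∘_; case_of_)
open import Function.Bundles using (Equivalence)
open import Relation.Nullary using (¬_; Dec; does; yes; no)
open import Relation.Binary.PropositionalEquality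

private
  variable
    n : ℕ

if-true : ∀ {A : Set} {b} {x y : A} → T b → (if b then x else y) ≡ x
if-true {b = true} _ = refl

if-false : ∀ {A : Set} {b} {x y : A} → ¬ T b → (if b then x else y) ≡ y
if-false {b = false} _ = refl
if-false {b = true} ¬tt = ⊥-elim (¬tt tt)

T-does⁻ : ∀ {A : Set} (a? : Dec A) → T (does a?) → A
T-does⁻ (yes a) _ = a

T-does⁺ : ∀ {A : Set} (a? : Dec A) → A → T (does a?)
T-does⁺ (yes _) _ = tt
T-does⁺ (no ¬a) a = ¬a a

minL-∈ : ∀ xs {μ} → minL xs ≡ just μ → μ ∈ xs
minL-∈ [] ()
minL-∈ (x ∷ xs) eq with minL xs in eq′
minL-∈ (x ∷ xs) refl | nothing = here refl
minL-∈ (x ∷ xs) refl | just y with ⊓-sel x y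
... | inj₁ x⊓y≡x rewrite x⊓y≡x = here refl
... | inj₂ x⊓y≡y rewrite x⊓y≡y = there (minL-∈ xs eq′)

firstJust-++ : ∀ {A B : Set} (f : A → Maybe B) xs ys → All (λ x → f x ≡ nothing) xs
             → firstJust f (xs ++ ys) ≡ firstJust f ys
firstJust-++ f [] ys [] = refl
firstJust-++ f (x ∷ xs) ys (fx≡nothing ∷ rest) with f x | fx≡nothing
... | nothing | refl = firstJust-++ f xs ys rest

firstJust-just⁻ : ∀ {A B : Set} (f : A → Maybe B) xs {y}
                → firstJust f xs ≡ just y → Any (λ x → f x ≡ just y) xs
firstJust-just⁻ f (x ∷ xs) eq with f x in fx
firstJust-just⁻ f (x ∷ xs) refl | just _ = here fx
... | nothing = there (firstJust-just⁻ f xs eq)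

firstJust-nothing⁻ : ∀ {A B : Set} (f : A → Maybe B) xs
                   → firstJust f xs ≡ nothing → All (λ x → f x ≡ nothing) xs
firstJust-nothing⁻ f [] _ = []
firstJust-nothing⁻ f (x ∷ xs) eq with f x in fx
... | nothing = fx ∷ firstJust-nothing⁻ f xs eq

All-take-++ : ∀ {A : Set} {P : A → Set} k (xs ys : List A)
            → k ≤ length xs → All P xs → All P (take k (xs ++ ys))
All-take-++ zero xs ys _ _ = []
All-take-++ (suc k) (x ∷ xs) ys (s≤s k≤) (px ∷ pxs) = px ∷ All-take-++ k xs ys k≤ pxs

∈-drop-++ : ∀ {A : Set} k (xs : List A) {y ys} → k ≤ length xs → y ∈ drop k (xs ++ y ∷ ys)
∈-drop-++ zero xs _ = ∈-++⁺ʳ xs (here refl)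
∈-drop-++ (suc k) (x ∷ xs) (s≤s k≤) = ∈-drop-++ k xs k≤

AllPairs-before : ∀ {A : Set} {R : A → A → Set} xs {y ys}
                → AllPairs R (xs ++ y ∷ ys) → All (λ x → R x y) xs
AllPairs-before [] _ = []
AllPairs-before (x ∷ xs) (Rx ∷ Rxs) = All.lookup Rx (∈-++⁺ʳ xs (here refl)) ∷ AllPairs-before xs Rxs

-- Labels t

Coarsens : (Fin n → ℕ) → (Fin n → ℕ) → Set
Coarsens f g = ∀ v v′ → f v ≡ f v′ → f v ≢ 0 → g v ≡ g v′ × g v ≢ 0

coarsens-refl : (f : Fin n → ℕ) → Coarsens f f
coarsens-refl f v v′ fv≡fv′ fv≢0 = fv≡fv′ , fv≢0

coarsens-trans : {f g h : Fin n → ℕ} → Coarsens f g → Coarsens g h → Coarsens f h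
coarsens-trans f⊑g g⊑h v v′ fv≡fv′ fv≢0 = uncurry (g⊑h v v′) (f⊑g v v′ fv≡fv′ fv≢0)

relabelling⇒coarsens : {f g : Fin n → ℕ} (r : ℕ → ℕ) → (∀ x → x ≢ 0 → r x ≢ 0)
                     → (∀ v → f v ≢ 0 → g v ≡ r (f v)) → Coarsens f g
relabelling⇒coarsens {f = f} {g} r r≢0 g≡rf v v′ fv≡fv′ fv≢0 = gv≡gv′ , gv≢0
  where
  open ≡-Reasoning
  gv≡gv′ : g v ≡ g v′
  gv≡gv′ = begin
    g v       ≡⟨ g≡rf v fv≢0 ⟩
    r (f v)   ≡⟨ cong r fv≡fv′ ⟩
    r (f v′)  ≡⟨ g≡rf v′ (fv≢0 ∘ trans fv≡fv′) ⟨
    g v′      ∎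
  gv≢0 : g v ≢ 0
  gv≢0 = r≢0 (f v) fv≢0 ∘ trans (sym (g≡rf v fv≢0))

-- Copies of the local definitions of step 5 of merge, written so as to be definitionally
-- equal to them (there v p 0 unfolds to vx C (toℕ p + 0)).
module MergeLabels (s : State n) (C : OCycle n) (J : Fin (len C) → Bool) where

  vx+0 : (p : Fin (len C)) → vx C (toℕ p + 0) ≡ vx C (toℕ p)
  vx+0 p = cong (vx C) (+-identityʳ (toℕ p))

  labelIfJ : Fin (len C) → List ℕ
  labelIfJ p = if J p then t s (vx C (toℕ p + 0)) ∷ [] else []

  M : List ℕ
  M = concatMap labelIfJ (allFin (len C))

  onC : Fin n → Bool
  onC w = any (λ p → does (w ≟F vx C (toℕ p + 0))) (allFin (len C))

  inM : ℕ → Bool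
  inM x = any (λ y → y ≡ᵇ x) M

  M⁻ : ∀ {x} → x ∈ M → ∃ λ p → J p ≡ true × x ≡ t s (vx C (toℕ p))
  M⁻ x∈M with find (∈-concatMap⁻ labelIfJ {xs = allFin (len C)} x∈M)
  ... | p , _ , x∈ with J p in Jp
  ... | true with x∈
  ... | here refl = p , Jp , cong (t s) (vx+0 p)

  M⁺ : (p : Fin (len C)) → J p ≡ true → T (inM (t s (vx C (toℕ p))))
  M⁺ p Jp = any⁺ _ (lose x∈M (≡⇒≡ᵇ (t s (vx C (toℕ p))) _ refl))
    where
    x∈M : t s (vx C (toℕ p)) ∈ M
    x∈M = ∈-concatMap⁺ labelIfJ (lose (∈-allFin p) x∈labelIfJ)
      where
      x∈labelIfJ : t s (vx C (toℕ p)) ∈ labelIfJ p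
      x∈labelIfJ rewrite Jp = here (cong (t s) (sym (vx+0 p)))

  onC⁻ : ∀ {w} → T (onC w) → ∃ λ p → w ≡ vx C (toℕ p)
  onC⁻ {w} onCw with find (any⁻ _ (allFin (len C)) onCw)
  ... | p , _ , w≟vp = p , trans (T-does⁻ (w ≟F vx C (toℕ p + 0)) w≟vp) (vx+0 p)

  mergedLabel : (∀ p → J p ≡ true → t s (vx C (toℕ p)) ≢ 0)
              → Σ ℕ λ a → a ≢ 0
                × (∀ w → t (merge s C J) w ≡ (if onC w then a else if inM (t s w) then a else t s w))
  mergedLabel J⇒≢0 with minL M in minM
  ... | nothing = suc (c s) , (λ ()) , λ w → refl
  ... | just μ  = μ , μ≢0 , λ w → refl
    where
    μ≢0 : μ ≢ 0
    μ≢0 with M⁻ (minL-∈ M minM)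
    ... | p , Jp , μ≡ = J⇒≢0 p Jp ∘ trans (sym μ≡)

  merge-relabels : ValidJ s C J → ∃ λ (r : ℕ → ℕ) → (∀ x → x ≢ 0 → r x ≢ 0)
                 × (∀ w → t s w ≢ 0 → t (merge s C J) w ≡ r (t s w))
  merge-relabels (J⇒≢0 , ≢0⇒J , _) with mergedLabel J⇒≢0
  ... | a , a≢0 , t′≡ = r , r≢0 , t′≡r
    where
    r : ℕ → ℕ
    r x = if inM x then a else x
    r≢0 : ∀ x → x ≢ 0 → r x ≢ 0
    r≢0 x x≢0 with inM x
    ... | true  = a≢0
    ... | false = x≢0
    onC⇒inM : ∀ w → T (onC w) → t s w ≢ 0 → T (inM (t s w))
    onC⇒inM w onCw tw≢0 with onC⁻ {w} onCw
    ... | p , refl with ≢0⇒J p tw≢0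
    ... | q , Jq , tq≡tp = subst (T ∘ inM) tq≡tp (M⁺ q Jq)
    t′≡r : ∀ w → t s w ≢ 0 → t (merge s C J) w ≡ r (t s w)
    t′≡r w tw≢0 with T? (onC w)
    ... | yes onCw = trans (t′≡ w) (trans (if-true onCw) (sym (if-true (onC⇒inM w onCw tw≢0))))
    ... | no ¬onCw = trans (t′≡ w) (if-false ¬onCw)

merge-coarsens : (s : State n) (C : OCycle n) (J : Fin (len C) → Bool)
               → ValidJ s C J → Coarsens (t s) (t (merge s C J))
merge-coarsens s C J valid with MergeLabels.merge-relabels s C J valid
... | r , r≢0 , t′≡r = relabelling⇒coarsens r r≢0 t′≡r

Coarsening : (Fin n → ℕ) → Trace n → Set
Coarsening f [] = ⊤
Coarsening f ((_ , s′) ∷ tr) = Coarsens f (t s′) × Coarsening (t s′) tr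

run-coarsening : ∀ {s : State n} {es tr s′} → Run s es tr s′ → Coarsening (t s) tr
run-coarsening done = tt
run-coarsening (next (acyclic _) run) = run-coarsening run
run-coarsening (next {s = s} {e = e} (found C J _ valid) run) =
  merge-coarsens (addEdge e s) C J valid , run-coarsening run

coarsening-stateAt : ∀ (s : State n) tr → Coarsening (t s) tr → ∀ {k ℓ} → k ≤ ℓ
                   → Coarsens (t (stateAt s tr k)) (t (stateAt s tr ℓ))
coarsening-stateAt s [] _ {zero} {zero} _ = coarsens-refl (t s)
coarsening-stateAt s [] _ {zero} {suc _} _ = coarsens-refl (t s)
coarsening-stateAt s [] _ {suc _} {suc _} _ = coarsens-refl (t s)
coarsening-stateAt s ((_ , s′) ∷ tr) _ {zero} {zero} _ = coarsens-refl (t s)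
coarsening-stateAt s ((_ , s′) ∷ tr) (s⊑s′ , rest) {zero} {suc ℓ} _ =
  coarsens-trans s⊑s′ (coarsening-stateAt s′ tr rest {ℓ = ℓ} z≤n)
coarsening-stateAt s ((_ , s′) ∷ tr) (_ , rest) {suc k} {suc ℓ} (s≤s k≤ℓ) =
  coarsening-stateAt s′ tr rest k≤ℓ

-- Edge-disjointness of the cycles

infix 4 _≡ᵘ_ _∈ᵘ_

_≡ᵘ_ : DEdge n → DEdge n → Set
x ≡ᵘ z = x ≡ z ⊎ x ≡ swap z

≡ᵘ-sym : {x z : DEdge n} → x ≡ᵘ z → z ≡ᵘ x
≡ᵘ-sym (inj₁ refl) = inj₁ refl
≡ᵘ-sym (inj₂ refl) = inj₂ refl

≡ᵘ-trans : {x y z : DEdge n} → x ≡ᵘ y → y ≡ᵘ z → x ≡ᵘ z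
≡ᵘ-trans (inj₁ refl) y≡ᵘz = y≡ᵘz
≡ᵘ-trans (inj₂ refl) (inj₁ refl) = inj₂ refl
≡ᵘ-trans (inj₂ refl) (inj₂ refl) = inj₁ refl

_∈ᵘ_ : DEdge n → List (DEdge n) → Set
x ∈ᵘ Es = Any (x ≡ᵘ_) Es

EdgeDisjoint : OCycle n → OCycle n → Set
EdgeDisjoint C C′ = ∀ {x} → x ∈E C → ¬ x ∈E C′

Covers : List (DEdge n) → OCycle n → Set
Covers Es C = ∀ {x} → x ∈E C → x ∈ᵘ Es

Disjointᵘ : List (DEdge n) → List (DEdge n) → Set
Disjointᵘ Es Es′ = ∀ {y} → y ∈ Es → ¬ y ∈ᵘ Es′

isCycleIn⇒covers : ∀ {Es} {C : OCycle n} → IsCycleIn Es C → Covers Es C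
isCycleIn⇒covers (_ , adjacent) (p , refl) with adjacent p
... | inj₁ e∈Es = lose e∈Es (inj₁ refl)
... | inj₂ e∈Es = lose e∈Es (inj₂ refl)

covers-⊆ : ∀ {Es Es′} {C : OCycle n} → Es ⊆ Es′ → Covers Es C → Covers Es′ C
covers-⊆ Es⊆Es′ covered = Any-resp-⊆ Es⊆Es′ ∘ covered

-- Copy of the local test isCEdge of step 6 of merge.
module MergeEdges (s : State n) (C : OCycle n) (J : Fin (len C) → Bool) where

  matchesᵘ : DEdge n → Fin (len C) → Bool
  matchesᵘ e p = does (e ≟E edgeOf C p) ∨ does (swap e ≟E edgeOf C p)

  onCycleᵘ : DEdge n → Bool
  onCycleᵘ e = any (matchesᵘ e) (allFin (len C))

  keepOff : DEdge n → List (DEdge n)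
  keepOff e = if onCycleᵘ e then [] else e ∷ []

  onCycleᵘ⁺ : ∀ {x z} → x ∈E C → x ≡ᵘ z → T (onCycleᵘ z)
  onCycleᵘ⁺ {z = z} (p , refl) x≡ᵘz =
    any⁺ (matchesᵘ z) (lose (∈-allFin p) (Equivalence.from T-∨ (matches x≡ᵘz)))
    where
    matches : edgeOf C p ≡ᵘ z → T (does (z ≟E edgeOf C p)) ⊎ T (does (swap z ≟E edgeOf C p))
    matches (inj₁ eq) = inj₁ (T-does⁺ (z ≟E edgeOf C p) (sym eq))
    matches (inj₂ eq) = inj₂ (T-does⁺ (swap z ≟E edgeOf C p) (sym eq))

  merge-Eint : ∀ {z} → z ∈ Eint (merge s C J) → z ∈ Eint s × (∀ {x} → x ∈E C → ¬ x ≡ᵘ z)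
  merge-Eint z∈ with find (∈-concatMap⁻ keepOff {xs = Eint s} z∈)
  ... | e , e∈ , z∈keep with onCycleᵘ e in off
  ... | false with z∈keep
  ... | here refl = e∈ , λ x∈C x≡ᵘe → subst T off (onCycleᵘ⁺ x∈C x≡ᵘe)

distinct⇒∉ᵘ : ∀ {e : DEdge n} {es} → All (λ e′ → (e ≢ e′) × (e ≢ swap e′)) es → ¬ e ∈ᵘ es
distinct⇒∉ᵘ = All¬⇒¬Any ∘ All.map (uncurry [_,_])

disjointᵘ-snoc : ∀ {Es} {e : DEdge n} {es}
               → Disjointᵘ Es (e ∷ es) → ¬ e ∈ᵘ es → Disjointᵘ (Es ++ e ∷ []) es
disjointᵘ-snoc {Es = Es} apart e∉ᵘes y∈ with ∈-++⁻ Es y∈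
... | inj₁ y∈Es = apart y∈Es ∘ there
... | inj₂ (here refl) = e∉ᵘes

disjointᵘ-⊆ : ∀ {Es Es′ es : List (DEdge n)} → Es′ ⊆ Es → Disjointᵘ Es es → Disjointᵘ Es′ es
disjointᵘ-⊆ Es′⊆Es apart = apart ∘ Es′⊆Es

found-cycle-disjoint : ∀ {Es Es′ es} {C : OCycle n} {Cs}
  → Covers Es C → (∀ {z} → z ∈ Es′ → z ∈ Es × (∀ {x} → x ∈E C → ¬ x ≡ᵘ z)) → Disjointᵘ Es es
  → AllPairs EdgeDisjoint Cs × All (Covers (Es′ ++ es)) Cs
  → AllPairs EdgeDisjoint (C ∷ Cs) × All (Covers (Es ++ es)) (C ∷ Cs)
found-cycle-disjoint {Es = Es} {Es′} {es} {C} coversC remains apart (disjoint , covered) =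
  All.map (λ {C′} → disjointFrom {C′}) covered ∷ disjoint ,
  covers-⊆ {C = C} ∈-++⁺ˡ coversC ∷ All.map (λ {C′} → covers-⊆ {C = C′} lift) covered
  where
  lift : Es′ ++ es ⊆ Es ++ es
  lift z∈ with ∈-++⁻ Es′ z∈
  ... | inj₁ z∈Es′ = ∈-++⁺ˡ (proj₁ (remains z∈Es′))
  ... | inj₂ z∈es = ∈-++⁺ʳ Es z∈es
  disjointFrom : ∀ {C′} → Covers (Es′ ++ es) C′ → EdgeDisjoint C C′
  disjointFrom coversC′ x∈C x∈C′ with ++⁻ Es′ (coversC′ x∈C′)
  ... | inj₁ x∈ᵘEs′ = let z , z∈Es′ , x≡ᵘz = find x∈ᵘEs′ in proj₂ (remains z∈Es′) x∈C x≡ᵘz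
  ... | inj₂ x∈ᵘes = let y , y∈Es , x≡ᵘy = find (coversC x∈C) in
                     apart y∈Es (Any.map (≡ᵘ-trans (≡ᵘ-sym x≡ᵘy)) x∈ᵘes)

covers-++-assoc : ∀ Es {e : DEdge n} {es Cs}
                → All (Covers ((Es ++ e ∷ []) ++ es)) Cs → All (Covers (Es ++ e ∷ es)) Cs
covers-++-assoc Es {e} {es} = subst (λ Es′ → All (Covers Es′) _) (++-assoc Es (e ∷ []) es)

run-cycles-disjoint : ∀ {s : State n} {es tr s′} → Run s es tr s′
  → AllPairs (λ e e′ → (e ≢ e′) × (e ≢ swap e′)) es → Disjointᵘ (Eint s) es
  → AllPairs EdgeDisjoint (cycles tr) × All (Covers (Eint s ++ es)) (cycles tr)
run-cycles-disjoint done _ _ = [] , []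
run-cycles-disjoint {s = s} (next (acyclic _) run) (e-distinct ∷ distinct) apart =
  map₂ (covers-++-assoc (Eint s))
    (run-cycles-disjoint run distinct (disjointᵘ-snoc apart (distinct⇒∉ᵘ e-distinct)))
run-cycles-disjoint {s = s} (next {e = e} {es} (found C J cycle _) run) (e-distinct ∷ distinct) apart =
  map₂ (covers-++-assoc (Eint s))
    (found-cycle-disjoint (isCycleIn⇒covers cycle) merge-Eint apart′
      (run-cycles-disjoint run distinct (disjointᵘ-⊆ (proj₁ ∘ merge-Eint) apart′)))
  where
  open MergeEdges (addEdge e s) C J
  apart′ : Disjointᵘ (Eint s ++ e ∷ []) es
  apart′ = disjointᵘ-snoc apart (distinct⇒∉ᵘ e-distinct)

-- The successor functions δ*_k and δ^c

modℕ-cong : ∀ L .{{_ : NonZero L}} i j → i % L ≡ j % L → i mod L ≡ j mod L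
modℕ-cong L i j i%≡j% = toℕ-injective (trans (toℕ-fromℕ< _) (trans i%≡j% (sym (toℕ-fromℕ< _))))

consecutive-∈E : (C : OCycle n) (i : ℕ) → (vx C i , vx C (suc i)) ∈E C
consecutive-∈E (ocycle m vs) i = q , cong₂ _,_ (cong vs (sym q≡i)) (cong vs (sym q+1≡i+1))
  where
  L : ℕ
  L = 3 + m
  q : Fin L
  q = i mod L
  toℕq : toℕ q ≡ i % L
  toℕq = toℕ-fromℕ< _
  q≡i : toℕ q mod L ≡ i mod L
  q≡i = modℕ-cong L (toℕ q) i (trans (cong (_% L) toℕq) (m%n%n≡m%n i L))
  q+1≡i+1 : suc (toℕ q) mod L ≡ suc i mod L
  q+1≡i+1 = modℕ-cong L (suc (toℕ q)) (suc i) (begin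
    suc (toℕ q) % L           ≡⟨ cong (λ x → suc x % L) toℕq ⟩
    (1 + i % L) % L           ≡⟨ %-distribˡ-+ 1 (i % L) L ⟩
    (1 % L + i % L % L) % L   ≡⟨ cong (λ x → (1 % L + x) % L) (m%n%n≡m%n i L) ⟩
    (1 % L + i % L) % L       ≡⟨ %-distribˡ-+ 1 i L ⟨
    suc i % L                 ∎)
    where open ≡-Reasoning

∈E-any⁺ : ∀ {e} {C : OCycle n} → e ∈E C → T (any (λ p → does (e ≟E edgeOf C p)) (allFin (len C)))
∈E-any⁺ {e = e} {C} (p , e≡) =
  any⁺ (λ p → does (e ≟E edgeOf C p)) (lose (∈-allFin p) (T-does⁺ (e ≟E edgeOf C p) e≡))

∈E-any⁻ : ∀ {e} {C : OCycle n} → T (any (λ p → does (e ≟E edgeOf C p)) (allFin (len C))) → e ∈E C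
∈E-any⁻ {e = e} {C} onC with find (any⁻ _ (allFin (len C)) onC)
... | p , _ , match = p , T-does⁻ (e ≟E edgeOf C p) match

inCycles⁺ : ∀ {e} {Cs : List (OCycle n)} → Any (e ∈E_) Cs → T (inCycles e Cs)
inCycles⁺ {e = e} = any⁺ _ ∘ Any.map (λ {C} → ∈E-any⁺ {C = C})

inCycles⁻ : ∀ {e} (Cs : List (OCycle n)) → T (inCycles e Cs) → Any (e ∈E_) Cs
inCycles⁻ Cs = Any.map (λ {C} → ∈E-any⁻ {C = C}) ∘ any⁻ _ Cs

δstar-on-later-cycle : ∀ (s₀ : State n) tr {pre C post} k {x} → cycles tr ≡ pre ++ C ∷ post
  → k ≤ length pre → All (λ C′ → ¬ x ∈E C′) pre → x ∈E C → δstar s₀ tr k x ≡ δc (cycles tr) x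
δstar-on-later-cycle s₀ tr {pre} {C} {post} k {x} Cs≡ k≤ avoid x∈C = begin
  δstar s₀ tr k x                                                           ≡⟨ if-false notBefore ⟩
  (if inCycles x (drop k (cycles tr)) then δc (cycles tr) x else nothing)  ≡⟨ if-true fromK ⟩
  δc (cycles tr) x                                                          ∎
  where
  open ≡-Reasoning
  notBefore : ¬ T (inCycles x (take k (cycles tr)))
  notBefore rewrite Cs≡ = All¬⇒¬Any (All-take-++ k pre (C ∷ post) k≤ avoid) ∘ inCycles⁻ _
  fromK : T (inCycles x (drop k (cycles tr)))
  fromK rewrite Cs≡ = inCycles⁺ (lose {P = x ∈E_} (∈-drop-++ k pre k≤) x∈C)

successorAt : DEdge n → (C : OCycle n) → Fin (len C) → Maybe (DEdge n)
successorAt e C p =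
  if does (e ≟E edgeOf C p) then just (vx C (suc (toℕ p)) , vx C (suc (suc (toℕ p)))) else nothing

cycleSucc : DEdge n → OCycle n → Maybe (DEdge n)
cycleSucc e C = firstJust (successorAt e C) (allFin (len C))

cycleSucc-just : ∀ {e y} (C : OCycle n) → cycleSucc e C ≡ just y → e ∈E C × y ∈E C
cycleSucc-just {e = e} C succ≡ with find (firstJust-just⁻ (successorAt e C) (allFin (len C)) succ≡)
... | p , _ , at≡ with e ≟E edgeOf C p | at≡
... | yes e≡ | refl = (p , e≡) , consecutive-∈E C (suc (toℕ p))

cycleSucc-∉ : ∀ {e} (C : OCycle n) → ¬ e ∈E C → cycleSucc e C ≡ nothing
cycleSucc-∉ {e = e} C e∉C with cycleSucc e C in succ≡
... | nothing = refl
... | just _ = ⊥-elim (e∉C (proj₁ (cycleSucc-just C succ≡)))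

cycleSucc-∈ : ∀ {e} (C : OCycle n) → e ∈E C → cycleSucc e C ≢ nothing
cycleSucc-∈ {e = e} C (p , e≡) succ≡
  with All.lookup (firstJust-nothing⁻ (successorAt e C) (allFin (len C)) succ≡) (∈-allFin p)
... | at≡ with e ≟E edgeOf C p | at≡
... | yes _ | ()
... | no e≢ | _ = e≢ e≡

δc-on-later-cycle : ∀ pre {C : OCycle n} post {x y} → All (λ C′ → ¬ x ∈E C′) pre → x ∈E C
                  → δc (pre ++ C ∷ post) x ≡ just y → y ∈E C
δc-on-later-cycle pre {C} post {x} {y} avoid x∈C δx≡ =
  closed (trans (sym (firstJust-++ (cycleSucc x) pre (C ∷ post) preSkipped)) δx≡)
  where
  preSkipped : All (λ C′ → cycleSucc x C′ ≡ nothing) pre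
  preSkipped = All.map (λ {C′} → cycleSucc-∉ C′) avoid
  closed : firstJust (cycleSucc x) (C ∷ post) ≡ just y → y ∈E C
  closed δx≡ with cycleSucc x C in succ≡
  ... | just _  = case δx≡ of λ { refl → proj₂ (cycleSucc-just {e = x} C succ≡) }
  ... | nothing = ⊥-elim (cycleSucc-∈ C x∈C succ≡)

iter-agree : ∀ (δ δ′ : DEdge n → Maybe (DEdge n)) (S : DEdge n → Set)
  → (∀ {x} → S x → δ x ≡ δ′ x) → (∀ {x y} → S x → δ′ x ≡ just y → S y)
  → ∀ m {x} → S x → iter δ m x ≡ iter δ′ m x
iter-agree δ δ′ S agree closed zero _ = refl
iter-agree δ δ′ S agree closed (suc m) {x} Sx rewrite agree Sx with δ′ x in δ′x≡
... | nothing = refl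
... | just y  = iter-agree δ δ′ S agree closed m (closed Sx δ′x≡)

iter-agree⇒sameClass : ∀ (δ δ′ : DEdge n → Maybe (DEdge n)) e
  → (∀ m → iter δ m e ≡ iter δ′ m e) → SameClass δ δ′ e
iter-agree⇒sameClass δ δ′ e iter≡ x =
  (λ (m , reach) → m , trans (sym (iter≡ (suc m))) reach) ,
  (λ (m , reach) → m , trans (iter≡ (suc m)) reach)

cycleAt-split : ∀ (tr : Trace n) ℓ {C} → cycleAt tr (suc ℓ) ≡ just C
  → ∃₂ λ pre post → cycles tr ≡ pre ++ C ∷ post × length pre ≡ ℓ
cycleAt-split (x ∷ tr) zero refl = [] , cycles tr , refl , refl
cycleAt-split (x ∷ tr) (suc ℓ) C≡ with cycleAt-split tr ℓ C≡
... | pre , post , tr≡ , length≡ = proj₁ x ∷ pre , post , cong (proj₁ x ∷_) tr≡ , cong suc length≡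

δstar-sameClass-on-later-cycle : ∀ (s₀ : State n) tr {k ℓ C e} → AllPairs EdgeDisjoint (cycles tr)
  → cycleAt tr (suc ℓ) ≡ just C → k ≤ ℓ → e ∈E C → SameClass (δstar s₀ tr k) (δc (cycles tr)) e
δstar-sameClass-on-later-cycle s₀ tr {k} {ℓ} {C} {e} disjoint C≡ k≤ℓ e∈C
  with cycleAt-split tr ℓ C≡
... | pre , post , tr≡ , refl =
  iter-agree⇒sameClass (δstar s₀ tr k) (δc (cycles tr)) e λ m →
    iter-agree (δstar s₀ tr k) (δc (cycles tr)) (_∈E C)
      (λ x∈C → δstar-on-later-cycle s₀ tr k tr≡ k≤ℓ (avoid x∈C) x∈C)
      (λ {x} x∈C δx≡ → δc-on-later-cycle pre post (avoid x∈C) x∈C (subst (λ Cs → δc Cs x ≡ _) tr≡ δx≡))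
      m e∈C
  where
  avoid : ∀ {x} → x ∈E C → All (λ C′ → ¬ x ∈E C′) pre
  avoid x∈C = All.map (λ C′∩C=∅ x∈C′ → C′∩C=∅ x∈C′ x∈C)
                      (AllPairs-before pre (subst (AllPairs EdgeDisjoint) tr≡ disjoint))

lemma6 : ∀ {n : ℕ} (es : List (DEdge n)) → SimpleStream es
         → (∀ (v : Fin n) → 2 ∣ degree es v)
         → ∀ (tr : Trace n) (sN : State n) → Run (initState n) es tr sN
         → ∀ (k ℓ : ℕ) → k < ℓ → ℓ ≤ length tr
         → (∀ (v v' : Fin n)
              → t (stateAt (initState n) tr k) v ≡ t (stateAt (initState n) tr k) v'
              → t (stateAt (initState n) tr k) v ≢ 0
              → t (stateAt (initState n) tr ℓ) v ≡ t (stateAt (initState n) tr ℓ) v')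
         × (∀ (e : DEdge n) → InRStar sN e
              → ∀ (C : OCycle n) → cycleAt tr ℓ ≡ just C → e ∈E C
              → SameClass (δstar (initState n) tr k) (δc (cycles tr)) e)
lemma6 {n} es (_ , distinct) _ tr _ run k (suc ℓ) (s≤s k≤ℓ) _ =
  (λ v v′ tv≡tv′ tv≢0 → proj₁ (labels-coarsen v v′ tv≡tv′ tv≢0)) ,
  (λ e _ C C≡ e∈C → δstar-sameClass-on-later-cycle (initState n) tr cyclesDisjoint C≡ k≤ℓ e∈C)
  where
  labels-coarsen : Coarsens (t (stateAt (initState n) tr k)) (t (stateAt (initState n) tr (suc ℓ)))
  labels-coarsen = coarsening-stateAt (initState n) tr (run-coarsening run) (m≤n⇒m≤1+n k≤ℓ)
  cyclesDisjoint : AllPairs EdgeDisjoint (cycles tr)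
  cyclesDisjoint = proj₁ (run-cycles-disjoint run distinct (λ ()))
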